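{- Let $m,n$ be positive odd integers with $m>n$, let $A\subset[n-1]$, and let $D$ be any domino tiling of $Y_A$. Then $$h(D)\equiv \frac{n-1}{4}-\frac{\#A}{2}+\#\bigl(A\cap(2\mathbb{Z}+1)\bigr)\pmod 2.$$
   Context: $[k]=\{1,\dots,k\}$ and $R_{a,b}=[a]\times[b]\subset\mathbb{Z}^2$. For a finite $X\subset\mathbb{Z}^2$, a domino tiling is a set $D$ of two-element subsets of $X$, each consisting of two adjacent points (distance $1$), such that each point of $X$ lies in exactly one element of $D$. A domino $\{(i,j),(i+1,j)\}$ is horizontal and $h(D)$ is the number of horizontal dominoes in $D$. Let $Y=\{(i,j)\in R_{m-1,n-1}\mid i+j<\frac{m+n}{2}\}$ and $Y_A=Y\cup\{(\frac{m+n}{2}-a,a)\mid a\in A\}$. -}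

module Defs where

open import Data.Nat using (ℕ; zero; suc; _+_; _*_; _∸_; _≤_; _<_; _≡ᵇ_)
open import Data.Nat.DivMod using (_%_)
open import Data.Bool using (Bool; true; false; _∧_; _∨_; if_then_else_)
open import Data.Product using (_×_; _,_; ∃; Σ)
open import Data.Sum using (_⊎_)
open import Data.List using (List; length; filter; filterᵇ)
open import Data.List.Membership.Propositional using (_∈_)
open import Data.List.Relation.Unary.All using (All)
open import Relation.Binary.PropositionalEquality using (_≡_)

-- Lattice points; all relevant points have positive coordinates, so ℕ × ℕ suffices.
Point : Set
Point = ℕ × ℕ

InRange : ℕ → ℕ → Set
InRange k x = 1 ≤ x × x ≤ k

-- A domino (a two-element set of adjacent points), encoded uniquely by its
-- lower-left cell and an orientation flag:
--   (p , true)  = {(i,j),(i+1,j)}  (horizontal)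
--   (p , false) = {(i,j),(i,j+1)}  (vertical)
Domino : Set
Domino = Point × Bool

first second : Domino → Point
first ((i , j) , _) = (i , j)
second ((i , j) , true)  = (suc i , j)
second ((i , j) , false) = (i , suc j)

isHorizontal : Domino → Bool
isHorizontal (_ , b) = b

_≡ᵖ_ : Point → Point → Bool
(i , j) ≡ᵖ (k , l) = (i ≡ᵇ k) ∧ (j ≡ᵇ l)

covers : Point → Domino → Bool
covers x d = (x ≡ᵖ first d) ∨ (x ≡ᵖ second d)

occurrences : Point → List Domino → ℕ
occurrences x D = length (filterᵇ (covers x) D)

IsDominoTiling : (Point → Set) → List Domino → Set
IsDominoTiling X D =
  All (λ d → X (first d) × X (second d)) D × (∀ x → X x → occurrences x D ≡ 1)

h : List Domino → ℕ
h D = length (filterᵇ isHorizontal D)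

-- Y = {(i,j) ∈ R_{m-1,n-1} | i + j < (m+n)/2}   (stated as 2(i+j) < m+n)
Y : ℕ → ℕ → Point → Set
Y m n (i , j) = InRange (m ∸ 1) i × InRange (n ∸ 1) j × 2 * (i + j) < m + n

-- Y_A = Y ∪ {((m+n)/2 - a, a) | a ∈ A}  (the point (i,a) with 2(i+a) = m+n)
YA : ℕ → ℕ → List ℕ → Point → Set
YA m n A (i , j) = Y m n (i , j) ⊎ (j ∈ A × 2 * (i + j) ≡ m + n)

isOdd : ℕ → Bool
isOdd a = (a % 2) ≡ᵇ 1

numOdd : List ℕ → ℕ
numOdd A = length (filterᵇ isOdd A)

-- Weight the cell (i , j) by 4j + 2.  A horizontal domino then weighs 8j + 4 and a vertical one
-- 8j + 8, so for a tiling D of Y_A the total weight of Y_A is −4 h(D) modulo 8.  With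
-- c = (m + n)/2 − 1, row j of Y has c − j cells, and rows 2t − 1 and 2t together weigh −2 modulo 8,
-- so Y weighs −(n − 1); the cell of Y_A outside Y in row a weighs 4a + 2 ≡ 2 + 4[a odd].  Hence
-- 4 h(D) ≡ (n − 1) − 2 #A − 4 #(A ∩ (2ℤ+1))  (mod 8), which is four times the claimed congruence.
module Submission where

open import Defs

module Enumeration where

  open import Data.Bool using (Bool; true; false; T; _∨_)
  open import Data.Bool.Properties using (T-∧; T-≡)
  open import Data.Empty using (⊥-elim)
  open import Data.List using (List; []; _∷_; _++_; map; length; filterᵇ)
  open import Data.List.Properties using (length-++; filter-++; map-++; map-cong; map-cong-local)
  open import Data.List.Relation.Unary.All as All using (All; []; _∷_)
  open import Data.List.Relation.Unary.All.Properties using (++⁺)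
  open import Data.Nat using (ℕ; _+_; _*_)
  open import Data.Nat.ListAction using (sum)
  open import Data.Nat.ListAction.Properties using (sum-++)
  open import Data.Nat.Properties
    using (≡ᵇ⇒≡; ≡⇒≡ᵇ; *-identityʳ; *-zeroʳ; *-distribˡ-+; 1+n≢n; +-commutativeSemigroup)
  open import Data.Product using (_×_; _,_; proj₁; proj₂)
  open import Data.Sum using (inj₁; inj₂)
  open import Data.Unit using (tt)
  open import Function.Bundles using (Equivalence)
  open import Level using (0ℓ)
  open import Relation.Nullary using (¬_)
  open import Relation.Unary using (Pred; _∪_; _≐′_; _⊥′_; ｛_｝)
  open import Relation.Binary.PropositionalEquality
  open import Algebra.Properties.CommutativeSemigroup +-commutativeSemigroup using (interchange)

  iverson : Bool → ℕ
  iverson true  = 1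
  iverson false = 0

  length-filterᵇ-∷ : ∀ {A : Set} (p : A → Bool) x xs →
    length (filterᵇ p (x ∷ xs)) ≡ iverson (p x) + length (filterᵇ p xs)
  length-filterᵇ-∷ p x xs with p x
  ... | true  = refl
  ... | false = refl

  iverson-∨ : ∀ a b → ¬ (T a × T b) → iverson (a ∨ b) ≡ iverson a + iverson b
  iverson-∨ true  true  ¬ab = ⊥-elim (¬ab (tt , tt))
  iverson-∨ true  false _   = refl
  iverson-∨ false b     _   = refl

  ≡ᵖ⇒≡ : ∀ x y → T (x ≡ᵖ y) → x ≡ y
  ≡ᵖ⇒≡ (i , j) (k , l) t with Equivalence.to T-∧ t
  ... | ti , tj = cong₂ _,_ (≡ᵇ⇒≡ i k ti) (≡ᵇ⇒≡ j l tj)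

  ≡ᵖ-refl : ∀ x → (x ≡ᵖ x) ≡ true
  ≡ᵖ-refl (i , j) = Equivalence.to T-≡ (Equivalence.from T-∧ (≡⇒≡ᵇ i i refl , ≡⇒≡ᵇ j j refl))

  first≢second : ∀ d → first d ≢ second d
  first≢second ((i , j) , true)  eq = 1+n≢n (sym (cong proj₁ eq))
  first≢second ((i , j) , false) eq = 1+n≢n (sym (cong proj₂ eq))

  sum-map-+ : ∀ {A : Set} (f g : A → ℕ) xs →
    sum (map (λ x → f x + g x) xs) ≡ sum (map f xs) + sum (map g xs)
  sum-map-+ f g []       = refl
  sum-map-+ f g (x ∷ xs) = trans (cong (f x + g x +_) (sum-map-+ f g xs))
    (interchange (f x) (g x) (sum (map f xs)) (sum (map g xs)))

  sum-map-++ : ∀ {A : Set} (f : A → ℕ) xs ys → sum (map f (xs ++ ys)) ≡ sum (map f xs) + sum (map f ys)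
  sum-map-++ f xs ys = trans (cong sum (map-++ f xs ys)) (sum-++ (map f xs) (map f ys))

  multiplicity : Point → List Point → ℕ
  multiplicity p xs = length (filterᵇ (_≡ᵖ p) xs)

  multiplicity-++ : ∀ p xs ys → multiplicity p (xs ++ ys) ≡ multiplicity p xs + multiplicity p ys
  multiplicity-++ p xs ys = trans (cong length (filter-++ _ xs ys)) (length-++ (filterᵇ (_≡ᵖ p) xs))

  multiplicity-outside : ∀ {X : Pred Point 0ℓ} p xs → All X xs → ¬ X p → multiplicity p xs ≡ 0
  multiplicity-outside p []       []         ¬Xp = refl
  multiplicity-outside {X} p (x ∷ xs) (Xx ∷ Xxs) ¬Xp
    rewrite length-filterᵇ-∷ (_≡ᵖ p) x xs with x ≡ᵖ p in eq
  ... | true  = ⊥-elim (¬Xp (subst X (≡ᵖ⇒≡ x p (Equivalence.from T-≡ eq)) Xx))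
  ... | false = multiplicity-outside p xs Xxs ¬Xp

  weight-at-≡ᵖ : ∀ (f : Point → ℕ) x p → f x * iverson (x ≡ᵖ p) ≡ f p * iverson (x ≡ᵖ p)
  weight-at-≡ᵖ f x p with x ≡ᵖ p in eq
  ... | true  = cong (λ y → f y * 1) (≡ᵖ⇒≡ x p (Equivalence.from T-≡ eq))
  ... | false = trans (*-zeroʳ (f x)) (sym (*-zeroʳ (f p)))

  sum-weight-≡ᵖ : ∀ (f : Point → ℕ) p xs →
    sum (map (λ x → f x * iverson (x ≡ᵖ p)) xs) ≡ f p * multiplicity p xs
  sum-weight-≡ᵖ f p []       = sym (*-zeroʳ (f p))
  sum-weight-≡ᵖ f p (x ∷ xs) = begin
    f x * iverson (x ≡ᵖ p) + sum (map (λ x → f x * iverson (x ≡ᵖ p)) xs)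
      ≡⟨ cong₂ _+_ (weight-at-≡ᵖ f x p) (sum-weight-≡ᵖ f p xs) ⟩
    f p * iverson (x ≡ᵖ p) + f p * multiplicity p xs
      ≡⟨ sym (*-distribˡ-+ (f p) (iverson (x ≡ᵖ p)) (multiplicity p xs)) ⟩
    f p * (iverson (x ≡ᵖ p) + multiplicity p xs)
      ≡⟨ cong (f p *_) (sym (length-filterᵇ-∷ (_≡ᵖ p) x xs)) ⟩
    f p * multiplicity p (x ∷ xs) ∎
    where open ≡-Reasoning

  occurrences-∷ : ∀ x d D →
    occurrences x (d ∷ D) ≡ iverson (x ≡ᵖ first d) + iverson (x ≡ᵖ second d) + occurrences x D
  occurrences-∷ x d D = trans (length-filterᵇ-∷ (covers x) d D)
    (cong (_+ occurrences x D) (iverson-∨ (x ≡ᵖ first d) (x ≡ᵖ second d) covers-both))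
    where
    covers-both : ¬ (T (x ≡ᵖ first d) × T (x ≡ᵖ second d))
    covers-both (t₁ , t₂) = first≢second d (trans (sym (≡ᵖ⇒≡ x (first d) t₁)) (≡ᵖ⇒≡ x (second d) t₂))

  sum-weight-occurrences : ∀ (f : Point → ℕ) xs D →
    sum (map (λ x → f x * occurrences x D) xs) ≡
    sum (map (λ d → f (first d) * multiplicity (first d) xs + f (second d) * multiplicity (second d) xs) D)
  sum-weight-occurrences f []       []      = refl
  sum-weight-occurrences f (x ∷ xs) []      rewrite *-zeroʳ (f x) = sum-weight-occurrences f xs []
  sum-weight-occurrences f xs       (d ∷ D) = begin
    sum (map (λ x → f x * occurrences x (d ∷ D)) xs)
      ≡⟨ cong sum (map-cong split xs) ⟩
    sum (map (λ x → (f x * iverson (x ≡ᵖ first d) + f x * iverson (x ≡ᵖ second d)) + f x * occurrences x D) xs)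
      ≡⟨ trans (sum-map-+ _ _ xs) (cong (_+ _) (sum-map-+ _ _ xs)) ⟩
    (sum (map (λ x → f x * iverson (x ≡ᵖ first d)) xs) + sum (map (λ x → f x * iverson (x ≡ᵖ second d)) xs))
      + sum (map (λ x → f x * occurrences x D) xs)
      ≡⟨ cong₂ _+_ (cong₂ _+_ (sum-weight-≡ᵖ f (first d) xs) (sum-weight-≡ᵖ f (second d) xs))
                   (sum-weight-occurrences f xs D) ⟩
    sum (map (λ d → f (first d) * multiplicity (first d) xs + f (second d) * multiplicity (second d) xs) (d ∷ D)) ∎
    where
    open ≡-Reasoning
    split : ∀ x → f x * occurrences x (d ∷ D) ≡
      (f x * iverson (x ≡ᵖ first d) + f x * iverson (x ≡ᵖ second d)) + f x * occurrences x D
    split x rewrite occurrences-∷ x d D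
      | *-distribˡ-+ (f x) (iverson (x ≡ᵖ first d) + iverson (x ≡ᵖ second d)) (occurrences x D)
      | *-distribˡ-+ (f x) (iverson (x ≡ᵖ first d)) (iverson (x ≡ᵖ second d)) = refl

  Enumerates : Pred Point 0ℓ → List Point → Set
  Enumerates X xs = All X xs × (∀ x → X x → multiplicity x xs ≡ 1)

  Enumerates-resp-≐ : ∀ {X Y xs} → X ≐′ Y → Enumerates X xs → Enumerates Y xs
  Enumerates-resp-≐ (X⊆Y , Y⊆X) (inX , once) = All.map (X⊆Y _) inX , λ x Yx → once x (Y⊆X x Yx)

  Enumerates-singleton : ∀ p → Enumerates ｛ p ｝ (p ∷ [])
  Enumerates-singleton p = refl ∷ [] , once
    where
    once : ∀ x → p ≡ x → multiplicity x (p ∷ []) ≡ 1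
    once x refl rewrite length-filterᵇ-∷ (_≡ᵖ x) x [] | ≡ᵖ-refl x = refl

  Enumerates-++ : ∀ {X Y xs ys} → Enumerates X xs → Enumerates Y ys → X ⊥′ Y →
    Enumerates (X ∪ Y) (xs ++ ys)
  Enumerates-++ {X} {Y} {xs} {ys} (inX , onceX) (inY , onceY) X⊥Y =
    ++⁺ (All.map inj₁ inX) (All.map inj₂ inY) , once
    where
    once : ∀ x → (X ∪ Y) x → multiplicity x (xs ++ ys) ≡ 1
    once x (inj₁ Xx) = begin
      multiplicity x (xs ++ ys)               ≡⟨ multiplicity-++ x xs ys ⟩
      multiplicity x xs + multiplicity x ys   ≡⟨ cong₂ _+_ (onceX x Xx)
                                                   (multiplicity-outside x ys inY (λ Yx → X⊥Y x (Xx , Yx))) ⟩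
      1 ∎
      where open ≡-Reasoning
    once x (inj₂ Yx) = begin
      multiplicity x (xs ++ ys)               ≡⟨ multiplicity-++ x xs ys ⟩
      multiplicity x xs + multiplicity x ys   ≡⟨ cong₂ _+_ (multiplicity-outside x xs inX (λ Xx → X⊥Y x (Xx , Yx)))
                                                   (onceY x Yx) ⟩
      1 ∎
      where open ≡-Reasoning

  sum-tiling : ∀ {X xs D} (f : Point → ℕ) → Enumerates X xs → IsDominoTiling X D →
    sum (map f xs) ≡ sum (map (λ d → f (first d) + f (second d)) D)
  sum-tiling {X} {xs} {D} f (inX , once) (cellsInX , covered) = begin
    sum (map f xs)
      ≡⟨ cong sum (map-cong-local (All.map (λ {x} Xx → weight-once x (covered x Xx)) inX)) ⟩
    sum (map (λ x → f x * occurrences x D) xs)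
      ≡⟨ sum-weight-occurrences f xs D ⟩
    sum (map (λ d → f (first d) * multiplicity (first d) xs + f (second d) * multiplicity (second d) xs) D)
      ≡⟨ cong sum (map-cong-local (All.map (λ {d} (Xf , Xs) →
           cong₂ _+_ (weight-once (first d) (once _ Xf)) (weight-once (second d) (once _ Xs))) cellsInX)) ⟨
    sum (map (λ d → f (first d) + f (second d)) D) ∎
    where
    open ≡-Reasoning
    weight-once : ∀ {k} x → k ≡ 1 → f x ≡ f x * k
    weight-once x refl = sym (*-identityʳ (f x))

module Regions where

  open Enumeration
  open import Data.Empty using (⊥-elim)
  open import Data.List using (List; []; _∷_; _++_; map)
  open import Data.List.Membership.Propositional using (_∈_)
  open import Data.List.Relation.Unary.All as All using (All; []; _∷_)
  open import Data.List.Relation.Unary.Any using (here; there)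
  open import Data.List.Relation.Unary.Unique.Propositional using (Unique; []; _∷_)
  open import Data.Nat using (ℕ; zero; suc; _+_; _*_; _∸_; _≤_; _<_; z≤n; s≤s)
  open import Data.Nat.Properties
  open import Data.Product using (_×_; _,_; proj₂)
  open import Data.Sum using (inj₁; inj₂)
  open import Relation.Unary using (_∪_; _≐′_; _⊥′_; ｛_｝)
  open import Relation.Binary.PropositionalEquality
  open import Data.Nat.Tactic.RingSolver using (solve-∀)

  row : ℕ → ℕ → List Point
  row j zero    = []
  row j (suc w) = (suc w , j) ∷ row j w

  Row : ℕ → ℕ → Point → Set
  Row j w (i , k) = InRange w i × k ≡ j

  Row-suc : ∀ j w → ｛ (suc w , j) ｝ ∪ Row j w ≐′ Row j (suc w)
  Row-suc j w = into , outof
    where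
    into : ∀ x → (｛ (suc w , j) ｝ ∪ Row j w) x → Row j (suc w) x
    into _       (inj₁ refl)                 = (s≤s z≤n , ≤-refl) , refl
    into (i , k) (inj₂ ((1≤i , i≤w) , k≡j)) = (1≤i , m≤n⇒m≤1+n i≤w) , k≡j
    outof : ∀ x → Row j (suc w) x → (｛ (suc w , j) ｝ ∪ Row j w) x
    outof (i , k) ((1≤i , i≤1+w) , k≡j) with m≤n⇒m<n∨m≡n i≤1+w
    ... | inj₁ i<1+w  = inj₂ ((1≤i , ≤-pred i<1+w) , k≡j)
    ... | inj₂ i≡1+w = inj₁ (cong₂ _,_ (sym i≡1+w) (sym k≡j))

  row-enumerates : ∀ j w → Enumerates (Row j w) (row j w)
  row-enumerates j zero    = [] , λ { (i , k) ((1≤i , i≤0) , _) → ⊥-elim (<-irrefl refl (≤-trans 1≤i i≤0)) }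
  row-enumerates j (suc w) = Enumerates-resp-≐ (Row-suc j w)
    (Enumerates-++ (Enumerates-singleton (suc w , j)) (row-enumerates j w) apart)
    where
    apart : ｛ (suc w , j) ｝ ⊥′ Row j w
    apart _ (refl , (_ , 1+w≤w) , _) = <-irrefl refl 1+w≤w

  staircase : ℕ → ℕ → List Point
  staircase u zero    = []
  staircase u (suc N) = row (suc N) u ++ staircase (suc u) N

  Staircase : ℕ → ℕ → Point → Set
  Staircase N c (i , j) = 1 ≤ i × InRange N j × i + j ≤ c

  Staircase-suc : ∀ u N → Row (suc N) u ∪ Staircase N (suc u + N) ≐′ Staircase (suc N) (u + suc N)
  Staircase-suc u N = into , outof
    where
    into : ∀ x → (Row (suc N) u ∪ Staircase N (suc u + N)) x → Staircase (suc N) (u + suc N) x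
    into (i , _) (inj₁ ((1≤i , i≤u) , refl)) = 1≤i , (s≤s z≤n , ≤-refl) , +-monoˡ-≤ (suc N) i≤u
    into (i , j) (inj₂ (1≤i , (1≤j , j≤N) , i+j≤c)) =
      1≤i , (1≤j , m≤n⇒m≤1+n j≤N) , subst (i + j ≤_) (sym (+-suc u N)) i+j≤c
    outof : ∀ x → Staircase (suc N) (u + suc N) x → (Row (suc N) u ∪ Staircase N (suc u + N)) x
    outof (i , j) (1≤i , (1≤j , j≤1+N) , i+j≤c) with m≤n⇒m<n∨m≡n j≤1+N
    ... | inj₁ j<1+N  = inj₂ (1≤i , (1≤j , ≤-pred j<1+N) , subst (i + j ≤_) (+-suc u N) i+j≤c)
    ... | inj₂ refl = inj₁ ((1≤i , +-cancelʳ-≤ (suc N) i u i+j≤c) , refl)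

  staircase-enumerates : ∀ u N → Enumerates (Staircase N (u + N)) (staircase u N)
  staircase-enumerates u zero    = [] , λ { (i , j) (_ , (1≤j , j≤0) , _) → ⊥-elim (<-irrefl refl (≤-trans 1≤j j≤0)) }
  staircase-enumerates u (suc N) = Enumerates-resp-≐ (Staircase-suc u N)
    (Enumerates-++ (row-enumerates (suc N) u) (staircase-enumerates (suc u) N) apart)
    where
    apart : Row (suc N) u ⊥′ Staircase N (suc u + N)
    apart (i , j) ((_ , refl) , _ , (_ , 1+N≤N) , _) = <-irrefl refl 1+N≤N

  antidiagonal : ℕ → List ℕ → List Point
  antidiagonal s = map (λ a → (s ∸ a , a))

  Antidiagonal : ℕ → List ℕ → Point → Set
  Antidiagonal s A (i , j) = j ∈ A × i + j ≡ s

  Antidiagonal-∷ : ∀ s a A → a ≤ s → ｛ (s ∸ a , a) ｝ ∪ Antidiagonal s A ≐′ Antidiagonal s (a ∷ A)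
  Antidiagonal-∷ s a A a≤s = into , outof
    where
    into : ∀ x → (｛ (s ∸ a , a) ｝ ∪ Antidiagonal s A) x → Antidiagonal s (a ∷ A) x
    into _       (inj₁ refl)        = here refl , m∸n+n≡m a≤s
    into (i , j) (inj₂ (j∈A , i+j≡s)) = there j∈A , i+j≡s
    outof : ∀ x → Antidiagonal s (a ∷ A) x → (｛ (s ∸ a , a) ｝ ∪ Antidiagonal s A) x
    outof (i , j) (here refl , i+a≡s) = inj₁ (cong (_, a) (trans (cong (_∸ a) (sym i+a≡s)) (m+n∸n≡m i a)))
    outof (i , j) (there j∈A , i+j≡s) = inj₂ (j∈A , i+j≡s)

  antidiagonal-enumerates : ∀ s A → Unique A → All (_≤ s) A → Enumerates (Antidiagonal s A) (antidiagonal s A)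
  antidiagonal-enumerates s []       _              _            = [] , λ { _ (() , _) }
  antidiagonal-enumerates s (a ∷ A) (a∉A ∷ unique) (a≤s ∷ A≤s) = Enumerates-resp-≐ (Antidiagonal-∷ s a A a≤s)
    (Enumerates-++ (Enumerates-singleton (s ∸ a , a)) (antidiagonal-enumerates s A unique A≤s) apart)
    where
    apart : ｛ (s ∸ a , a) ｝ ⊥′ Antidiagonal s A
    apart _ (refl , a∈A , _) = All.lookup a∉A a∈A refl

  Staircase⊥Antidiagonal : ∀ N c A → Staircase N c ⊥′ Antidiagonal (suc c) A
  Staircase⊥Antidiagonal N c A (i , j) ((_ , _ , i+j≤c) , (_ , i+j≡1+c)) =
    <-irrefl refl (subst (_≤ c) i+j≡1+c i+j≤c)

  half-perimeter-bounds : ∀ {m n s} → n ≤ m → m + n ≡ 2 * s → n ≤ s × s ≤ m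
  half-perimeter-bounds {m} {n} {s} n≤m m+n≡2s =
      *-cancelˡ-≤ 2 (begin 2 * n ≡⟨ double n ⟩ n + n ≤⟨ +-monoˡ-≤ n n≤m ⟩ m + n ≡⟨ m+n≡2s ⟩ 2 * s ∎)
    , *-cancelˡ-≤ 2 (begin 2 * s ≡⟨ m+n≡2s ⟨ m + n ≤⟨ +-monoʳ-≤ m n≤m ⟩ m + m ≡⟨ double m ⟨ 2 * m ∎)
    where
    open ≤-Reasoning
    double : ∀ k → 2 * k ≡ k + k
    double k = cong (k +_) (+-identityʳ k)

  YA-≐ : ∀ {m n N c} A → n ≡ suc N → m + n ≡ 2 * suc c → n ≤ m →
    Staircase N c ∪ Antidiagonal (suc c) A ≐′ YA m n A
  YA-≐ {m} {n} {N} {c} A refl m+n≡2s n≤m = into , outof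
    where
    c≤m∸1 : c ≤ m ∸ 1
    c≤m∸1 = ∸-monoˡ-≤ {suc c} 1 (proj₂ (half-perimeter-bounds n≤m m+n≡2s))
    into : ∀ x → (Staircase N c ∪ Antidiagonal (suc c) A) x → YA m n A x
    into (i , j) (inj₁ (1≤i , j∈[N] , i+j≤c)) =
      inj₁ ( (1≤i , ≤-trans (≤-trans (m≤m+n i j) i+j≤c) c≤m∸1)
           , j∈[N]
           , subst (2 * (i + j) <_) (sym m+n≡2s) (*-monoʳ-< 2 (s≤s i+j≤c)))
    into (i , j) (inj₂ (j∈A , i+j≡1+c)) = inj₂ (j∈A , trans (cong (2 *_) i+j≡1+c) (sym m+n≡2s))
    outof : ∀ x → YA m n A x → (Staircase N c ∪ Antidiagonal (suc c) A) x
    outof (i , j) (inj₁ ((1≤i , _) , j∈[N] , 2[i+j]<m+n)) =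
      inj₁ (1≤i , j∈[N] , ≤-pred (*-cancelˡ-< 2 (i + j) (suc c) (subst (2 * (i + j) <_) m+n≡2s 2[i+j]<m+n)))
    outof (i , j) (inj₂ (j∈A , 2[i+j]≡m+n)) = inj₂ (j∈A , *-cancelˡ-≡ (i + j) (suc c) 2 (trans 2[i+j]≡m+n m+n≡2s))

  odd-half-perimeter : ∀ k l → l ≤ k → (2 * k + 1) + (2 * l + 1) ≡ 2 * suc ((k ∸ l) + 2 * l)
  odd-half-perimeter k l l≤k = begin
    (2 * k + 1) + (2 * l + 1)                ≡⟨ cong (λ t → 2 * t + 1 + (2 * l + 1)) (m∸n+n≡m l≤k) ⟨
    (2 * ((k ∸ l) + l) + 1) + (2 * l + 1)    ≡⟨ regroup (k ∸ l) l ⟩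
    2 * suc ((k ∸ l) + 2 * l)                ∎
    where
    open ≡-Reasoning
    regroup : ∀ u l → (2 * (u + l) + 1) + (2 * l + 1) ≡ 2 * suc (u + 2 * l)
    regroup = solve-∀

module Weights where

  open Enumeration using (iverson; length-filterᵇ-∷; sum-map-++)
  open Regions using (row; staircase; antidiagonal)
  open import Data.Bool using (true; false)
  open import Data.List using (List; []; _∷_; _++_; map; length)
  open import Data.Nat using (ℕ; zero; suc; _+_; _*_)
  open import Data.Nat.Divisibility using (_∣_; _∣0; ∣-refl; ∣m∣n⇒∣m+n; m∣m*n; divides)
  open import Data.Nat.ListAction using (sum)
  open import Data.Nat.Properties using (*-suc)
  open import Data.Nat.Tactic.RingSolver using (solve-∀)
  open import Data.Product using (_,_; proj₂)
  open import Relation.Binary.PropositionalEquality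

  weight : Point → ℕ
  weight (_ , j) = 4 * j + 2

  domino-weight : ∀ d → weight (first d) + weight (second d) + 4 * iverson (isHorizontal d) ≡ 8 * suc (proj₂ (first d))
  domino-weight ((_ , j) , true)  = horizontal j
    where
    horizontal : ∀ j → 4 * j + 2 + (4 * j + 2) + 4 * 1 ≡ 8 * suc j
    horizontal = solve-∀
  domino-weight ((_ , j) , false) = vertical j
    where
    vertical : ∀ j → 4 * j + 2 + (4 * suc j + 2) + 4 * 0 ≡ 8 * suc j
    vertical = solve-∀

  tiling-weight : ∀ D → 8 ∣ sum (map (λ d → weight (first d) + weight (second d)) D) + 4 * h D
  tiling-weight []      = 8 ∣0
  tiling-weight (d ∷ D) = subst (8 ∣_) (sym regrouped) (∣m∣n⇒∣m+n (m∣m*n (suc (proj₂ (first d)))) (tiling-weight D))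
    where
    open ≡-Reasoning
    cells rest : ℕ
    cells = weight (first d) + weight (second d)
    rest  = sum (map (λ d → weight (first d) + weight (second d)) D)
    regroup : ∀ a b c e → a + b + 4 * (c + e) ≡ (a + 4 * c) + (b + 4 * e)
    regroup = solve-∀
    regrouped : cells + rest + 4 * h (d ∷ D) ≡ 8 * suc (proj₂ (first d)) + (rest + 4 * h D)
    regrouped = begin
      cells + rest + 4 * h (d ∷ D)                               ≡⟨ cong (λ t → cells + rest + 4 * t) (length-filterᵇ-∷ isHorizontal d D) ⟩
      cells + rest + 4 * (iverson (isHorizontal d) + h D)        ≡⟨ regroup cells rest (iverson (isHorizontal d)) (h D) ⟩
      (cells + 4 * iverson (isHorizontal d)) + (rest + 4 * h D)  ≡⟨ cong (_+ (rest + 4 * h D)) (domino-weight d) ⟩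
      8 * suc (proj₂ (first d)) + (rest + 4 * h D)               ∎

  row-weight : ∀ j w → sum (map weight (row j w)) ≡ w * (4 * j + 2)
  row-weight j zero    = refl
  row-weight j (suc w) = cong (4 * j + 2 +_) (row-weight j w)

  staircase-weight : ∀ l u → 8 ∣ sum (map weight (staircase u (2 * l))) + 2 * l
  staircase-weight zero    u = 8 ∣0
  staircase-weight (suc l) u =
    subst (λ M → 8 ∣ sum (map weight (staircase u M)) + M) (sym (*-suc 2 l))
      (subst (8 ∣_) (sym regrouped) (∣m∣n⇒∣m+n (m∣m*n (suc l * (2 * u + 1))) (staircase-weight l (suc (suc u)))))
    where
    open ≡-Reasoning
    N : ℕ
    N = 2 * l
    top next : List Point
    top  = row (suc (suc N)) u
    next = row (suc N) (suc u)
    rest : ℕ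
    rest = sum (map weight (staircase (suc (suc u)) N))
    pair : ∀ u l r → u * (4 * suc (suc (2 * l)) + 2) + (suc u * (4 * suc (2 * l) + 2) + r) + suc (suc (2 * l))
                     ≡ 8 * (suc l * (2 * u + 1)) + (r + 2 * l)
    pair = solve-∀
    regrouped : sum (map weight (top ++ (next ++ staircase (suc (suc u)) N))) + suc (suc N)
                ≡ 8 * (suc l * (2 * u + 1)) + (rest + N)
    regrouped = begin
      sum (map weight (top ++ (next ++ staircase (suc (suc u)) N))) + suc (suc N)
        ≡⟨ cong (_+ suc (suc N)) (trans (sum-map-++ weight top _) (cong (sum (map weight top) +_) (sum-map-++ weight next _))) ⟩
      sum (map weight top) + (sum (map weight next) + rest) + suc (suc N)
        ≡⟨ cong (λ t → t + (sum (map weight next) + rest) + suc (suc N)) (row-weight (suc (suc N)) u) ⟩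
      u * (4 * suc (suc N) + 2) + (sum (map weight next) + rest) + suc (suc N)
        ≡⟨ cong (λ t → u * (4 * suc (suc N) + 2) + (t + rest) + suc (suc N)) (row-weight (suc N) (suc u)) ⟩
      u * (4 * suc (suc N) + 2) + (suc u * (4 * suc N + 2) + rest) + suc (suc N)
        ≡⟨ pair u l rest ⟩
      8 * (suc l * (2 * u + 1)) + (rest + N) ∎

  odd-weight : ∀ a → 8 ∣ 4 * a + 2 + 4 * iverson (isOdd a) + 6
  odd-weight zero          = ∣-refl
  odd-weight (suc zero)    = divides 2 refl
  odd-weight (suc (suc a)) = subst (8 ∣_) (sym (shift a (iverson (isOdd a)))) (∣m∣n⇒∣m+n ∣-refl (odd-weight a))
    where
    shift : ∀ a i → 4 * suc (suc a) + 2 + 4 * i + 6 ≡ 8 + (4 * a + 2 + 4 * i + 6)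
    shift = solve-∀

  antidiagonal-weight : ∀ s A → 8 ∣ sum (map weight (antidiagonal s A)) + 4 * numOdd A + 6 * length A
  antidiagonal-weight s []      = 8 ∣0
  antidiagonal-weight s (a ∷ A) = subst (8 ∣_) (sym regrouped) (∣m∣n⇒∣m+n (odd-weight a) (antidiagonal-weight s A))
    where
    open ≡-Reasoning
    rest : ℕ
    rest = sum (map weight (antidiagonal s A))
    regroup : ∀ a r i o n → 4 * a + 2 + r + 4 * (i + o) + 6 * suc n ≡ (4 * a + 2 + 4 * i + 6) + (r + 4 * o + 6 * n)
    regroup = solve-∀
    regrouped : 4 * a + 2 + rest + 4 * numOdd (a ∷ A) + 6 * suc (length A)
                ≡ (4 * a + 2 + 4 * iverson (isOdd a) + 6) + (rest + 4 * numOdd A + 6 * length A)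
    regrouped = trans (cong (λ t → 4 * a + 2 + rest + 4 * t + 6 * suc (length A)) (length-filterᵇ-∷ isOdd a A))
                      (regroup a rest (iverson (isOdd a)) (numOdd A) (length A))

module Residues where

  open import Data.Integer as ℤ using (+_)
  import Data.Integer.Divisibility.Signed as Signed
  open Signed using (∣ᵤ⇒∣; ∣⇒∣ᵤ; ∣m∣n⇒∣m-n)
  open import Data.Integer.Properties using (pos-+)
  import Data.Integer.Divisibility as ℤ
  open import Data.Integer.Tactic.RingSolver using (solve-∀)
  open import Data.Nat using (_+_; _*_)
  open import Data.Nat.Divisibility using (_∣_; ∣m∣n⇒∣m+n; m∣m*n)
  import Data.Nat.Tactic.RingSolver as ℕ-Solver
  open import Relation.Binary.PropositionalEquality

  ∣-difference : ∀ {d} p q x → d ∣ p + x → d ∣ q + x → + d ℤ.∣ + p ℤ.- + q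
  ∣-difference {d} p q x d∣p+x d∣q+x = ∣⇒∣ᵤ (subst (Signed._∣_ (+ d)) cancel
    (∣m∣n⇒∣m-n (∣ᵤ⇒∣ {+ d} {+ (p + x)} d∣p+x) (∣ᵤ⇒∣ {+ d} {+ (q + x)} d∣q+x)))
    where
    cancel : + (p + x) ℤ.- + (q + x) ≡ + p ℤ.- + q
    cancel rewrite pos-+ p x | pos-+ q x = cancelˡ (+ p) (+ q) (+ x)
      where
      cancelˡ : ∀ P Q X → (P ℤ.+ X) ℤ.- (Q ℤ.+ X) ≡ P ℤ.- Q
      cancelˡ = solve-∀

  mod8-combine : ∀ y z h l a o → 8 ∣ y + z + 4 * h → 8 ∣ y + 2 * l → 8 ∣ z + 4 * o + 6 * a →
    + 8 ℤ.∣ ((+ (4 * h) ℤ.- + (2 * l) ℤ.+ + (2 * a)) ℤ.- + (4 * o))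
  mod8-combine y z h l a o 8∣tiling 8∣stairs 8∣antidiagonal =
    -- shifting both sides by y + z + 6a turns them into sums of the three hypotheses
    subst (+ 8 ℤ.∣_) regroup (∣-difference (4 * h + 2 * a) (2 * l + 4 * o) (y + z + 6 * a)
      (subst (8 ∣_) (sym (with-tiling y z h a)) (∣m∣n⇒∣m+n 8∣tiling (m∣m*n a)))
      (subst (8 ∣_) (sym (with-regions y z l o a)) (∣m∣n⇒∣m+n 8∣stairs 8∣antidiagonal)))
    where
    with-tiling : ∀ y z h a → 4 * h + 2 * a + (y + z + 6 * a) ≡ y + z + 4 * h + 8 * a
    with-tiling = ℕ-Solver.solve-∀
    with-regions : ∀ y z l o a → 2 * l + 4 * o + (y + z + 6 * a) ≡ y + 2 * l + (z + 4 * o + 6 * a)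
    with-regions = ℕ-Solver.solve-∀
    regroup : + (4 * h + 2 * a) ℤ.- + (2 * l + 4 * o) ≡ (+ (4 * h) ℤ.- + (2 * l) ℤ.+ + (2 * a)) ℤ.- + (4 * o)
    regroup rewrite pos-+ (4 * h) (2 * a) | pos-+ (2 * l) (4 * o) = rearrange (+ (4 * h)) (+ (2 * a)) (+ (2 * l)) (+ (4 * o))
      where
      rearrange : ∀ H A L O → (H ℤ.+ A) ℤ.- (L ℤ.+ O) ≡ (H ℤ.- L ℤ.+ A) ℤ.- O
      rearrange = solve-∀

open Enumeration using (Enumerates; Enumerates-resp-≐; Enumerates-++; sum-tiling; sum-map-++)
open Regions
  using ( staircase; antidiagonal; staircase-enumerates; antidiagonal-enumerates; Staircase⊥Antidiagonal
        ; YA-≐; half-perimeter-bounds; odd-half-perimeter)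
open Weights using (weight; tiling-weight; staircase-weight; antidiagonal-weight)
open Residues using (mod8-combine)

open import Data.Nat using (ℕ; suc; _<_; _∸_)
open import Data.Nat as ℕ using ()
open import Data.Nat.Divisibility as ℕ using ()
open import Data.Nat.ListAction using (sum)
open import Data.Nat.Properties using (<⇒≤; ≤-trans; m∸n≤m; m+n∸n≡m; +-comm; +-cancelʳ-≤; *-cancelˡ-≤)
open import Data.Integer using (ℤ; +_; _-_; _+_)
open import Data.Integer.Divisibility using (_∣_)
open import Data.List using (List; length; map; _++_)
open import Data.List.Relation.Unary.All as All using (All)
open import Data.List.Relation.Unary.Unique.Propositional using (Unique)
open import Data.Product using (_,_; proj₁)
open import Relation.Binary.PropositionalEquality using (_≡_; refl; sym; trans; subst)

lemma4p11 : (m n k l : ℕ) → m ≡ 2 ℕ.* k ℕ.+ 1 → n ≡ 2 ℕ.* l ℕ.+ 1 → n < m →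
    (A : List ℕ) → Unique A → All (InRange (n ∸ 1)) A →
    (D : List Domino) → IsDominoTiling (YA m n A) D →
    (+ 8) ∣ ((+ (4 ℕ.* h D) - + (n ∸ 1) + + (2 ℕ.* length A)) - + (4 ℕ.* numOdd A))
lemma4p11 m n k l refl refl n<m A unique A⊆[n-1] D tiling =
  subst (λ t → + 8 ∣ ((+ (4 ℕ.* h D) - + t + + (2 ℕ.* length A)) - + (4 ℕ.* numOdd A)))
    (sym (m+n∸n≡m (2 ℕ.* l) 1))
    (mod8-combine (Σweight stairs) (Σweight diagonal) (h D) l (length A) (numOdd A)
      tiling-mod8 (staircase-weight l u) (antidiagonal-weight (suc c) A))
  where
  u c : ℕ
  u = k ∸ l
  c = u ℕ.+ 2 ℕ.* l
  stairs diagonal : List Point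
  stairs   = staircase u (2 ℕ.* l)
  diagonal = antidiagonal (suc c) A
  Σweight : List Point → ℕ
  Σweight xs = sum (map weight xs)
  n≤m : n ℕ.≤ m
  n≤m = <⇒≤ n<m
  m+n≡2[1+c] : m ℕ.+ n ≡ 2 ℕ.* suc c
  m+n≡2[1+c] = odd-half-perimeter k l (*-cancelˡ-≤ 2 (+-cancelʳ-≤ 1 (2 ℕ.* l) (2 ℕ.* k) n≤m))
  A≤1+c : All (ℕ._≤ suc c) A
  A≤1+c = All.map (λ (_ , a≤n∸1) → ≤-trans a≤n∸1 (≤-trans (m∸n≤m n 1) (proj₁ (half-perimeter-bounds n≤m m+n≡2[1+c]))))
    A⊆[n-1]
  cells : Enumerates (YA m n A) (stairs ++ diagonal)
  cells = Enumerates-resp-≐ (YA-≐ A (+-comm (2 ℕ.* l) 1) m+n≡2[1+c] n≤m)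
    (Enumerates-++ (staircase-enumerates u (2 ℕ.* l)) (antidiagonal-enumerates (suc c) A unique A≤1+c)
      (Staircase⊥Antidiagonal (2 ℕ.* l) c A))
  tiling-mod8 : 8 ℕ.∣ Σweight stairs ℕ.+ Σweight diagonal ℕ.+ 4 ℕ.* h D
  tiling-mod8 = subst (λ t → 8 ℕ.∣ t ℕ.+ 4 ℕ.* h D)
    (trans (sym (sum-tiling weight cells tiling)) (sum-map-++ weight stairs diagonal))
    (tiling-weight D)
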